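{- For an integer $r\ge 2$, let $C_r$ be the largest constant such that for every finite, simple, undirected, connected graph $G$ with at least two vertices and for all vertices $x_1,\ldots,x_r$ of $G$, $$\gamma(G)\ge C_r\sum_{1\le i<j\le r} d_G(x_i,x_j).$$ Then for every $r\ge 3$, $C_r=\dfrac{1}{r^2-r}$.
   Context: A set $S\subseteq V(G)$ is a dominating set of $G$ if every vertex of $G$ either belongs to $S$ or is adjacent to a vertex of $S$. The domination number $\gamma(G)$ is the minimum cardinality of a dominating set of $G$. $d_G(x,y)$ denotes the length of a shortest $x$–$y$ path in $G$.
   Formalization: The constants compared with $C_r$ in the largest-constant condition range only over the rationals. -}

module Defs where

open import Data.Nat using (ℕ; zero; suc; _+_; _*_; _∸_; _≤_; _<ᵇ_)
open import Data.Fin using (Fin; toℕ)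
open import Data.Fin.Subset using (Subset; _∈_; ∣_∣)
open import Data.Bool using (Bool; true; false; if_then_else_)
open import Data.List using (List; map; allFin)
open import Data.Nat.ListAction using (sum)
open import Data.Product using (Σ; ∃; _×_)
open import Data.Sum using (_⊎_)
open import Relation.Binary.PropositionalEquality using (_≡_)
open import Relation.Nullary using (¬_)
import Data.Integer as ℤ
open import Data.Rational using (ℚ; _/_; 0ℚ)
  renaming (_*_ to _*ℚ_; _≤_ to _≤ℚ_)

record Graph (n : ℕ) : Set where
  field
    adj   : Fin n → Fin n → Bool
    sym   : ∀ x y → adj x y ≡ adj y x
    irrefl : ∀ x → adj x x ≡ false
open Graph public

data Walk {n : ℕ} (G : Graph n) : Fin n → Fin n → ℕ → Set where
  here : ∀ x → Walk G x x 0
  step : ∀ {x y z k} → adj G x y ≡ true → Walk G y z k → Walk G x z (suc k)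

Connected : ∀ {n} → Graph n → Set
Connected G = ∀ x y → ∃ λ k → Walk G x y k

IsDist : ∀ {n} → Graph n → Fin n → Fin n → ℕ → Set
IsDist G x y k = Walk G x y k × (∀ m → Walk G x y m → k ≤ m)

Dominating : ∀ {n} → Graph n → Subset n → Set
Dominating {n} G S = ∀ v → v ∈ S ⊎ (∃ λ u → u ∈ S × adj G v u ≡ true)

IsDomNum : ∀ {n} → Graph n → ℕ → Set
IsDomNum G g = (∃ λ S → Dominating G S × ∣ S ∣ ≡ g)
             × (∀ S → Dominating G S → g ≤ ∣ S ∣)

pairSum : (r : ℕ) → (Fin r → Fin r → ℕ) → ℕ
pairSum r d = sum (map (λ i → sum (map (λ j → if toℕ i <ᵇ toℕ j then d i j else 0)
                                        (allFin r)))
                       (allFin r))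

toℚ : ℕ → ℚ
toℚ k = ℤ.+ k / 1

Valid : ℕ → ℚ → Set
Valid r c = ∀ (n : ℕ) (G : Graph n) → 2 ≤ n → Connected G →
            ∀ (g : ℕ) → IsDomNum G g →
            ∀ (x : Fin r → Fin n) (d : Fin r → Fin r → ℕ) →
            (∀ i j → IsDist G (x i) (x j) (d i j)) →
            c *ℚ toℚ (pairSum r d) ≤ℚ toℚ g

-- 1 / (r² − r); written with r² − r = r·(r − 1). Values for r < 2 are irrelevant.
Cr : ℕ → ℚ
Cr zero = 0ℚ
Cr (suc zero) = 0ℚ
Cr (suc (suc k)) = ℤ.+ 1 / (suc (suc k) * (suc (suc k) ∸ 1))

-- Let S be a minimum dominating set. The dominators of consecutive vertices of a walk are at
-- distance at most 3, so a walk between two vertices of S yields a chain of S-vertices with hops of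
-- length at most 3, which may be taken without repetitions. Given x, y, z with dominators a, b, c,
-- take such a chain P from a to b and a chain from c up to its first vertex w on P; they are
-- disjoint, so x, y and z reach w by walks of total length at most 3γ, whence
-- d(x,y) + d(x,z) + d(y,z) ≤ 6γ. Summing over all triples of the x_i, where each pair occurs r − 2
-- times, gives Σ d(x_i,x_j) ≤ r(r−1)γ. The leaves of the star K_{1,r} attain this: γ = 1 and all
-- r(r−1)/2 distances equal 2.

module Submission where

open import Defs
open import Data.Nat using (ℕ; _≤_)
open import Data.Product using (_×_)
open import Relation.Nullary using (¬_)
open import Data.Rational using (ℚ; _<_)

open import Algebra.Properties.CommutativeSemigroup using (interchange)
open import Data.Bool using (Bool; true; false; if_then_else_)
open import Data.Empty using (⊥-elim)
open import Data.Fin using (Fin; zero; suc; toℕ; _≟_)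
open import Data.Fin.Properties using (suc-injective)
open import Data.Fin.Subset using (Subset; ∣_∣; ⁅_⁆; _-_) renaming (_∈_ to _∈ₛ_)
open import Data.Fin.Subset.Properties using (x∈⁅x⁆; ∣⁅x⁆∣≡1; x∈p∧x≢y⇒x∈p-y; x∈p⇒∣p-x∣<∣p∣)
import Data.Integer as ℤ
import Data.Integer.Properties as ℤ
open import Data.List using (List; []; _∷_; [_]; length; _++_; map; allFin; tabulate)
open import Data.List.Properties using (length-++; map-tabulate)
open import Data.List.Relation.Unary.All as All using (All; []; _∷_)
import Data.List.Relation.Unary.All.Properties as All
open import Data.List.Relation.Unary.AllPairs using ([]; _∷_)
open import Data.List.Relation.Unary.Any using (here; there)
open import Data.List.Relation.Unary.Unique.Propositional using (Unique)
import Data.List.Relation.Unary.Unique.Propositional.Properties as Unique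
open import Data.Nat using (zero; suc; _+_; _*_; _∸_; _<ᵇ_; z≤n; s≤s; NonZero)
import Data.Nat.ListAction as List
open import Data.Nat.Properties
  using ( ≤-refl; ≤-reflexive; ≤-trans; +-mono-≤; +-monoˡ-≤; +-monoʳ-≤; *-monoʳ-≤; *-cancelˡ-≤
        ; +-assoc; +-comm; *-comm; *-suc; *-identityʳ; *-distribˡ-+; *-distribʳ-+
        ; +-0-commutativeMonoid; +-commutativeSemigroup; module ≤-Reasoning)
open import Data.Nat.Tactic.RingSolver using (solve-∀)
open import Data.Product using (∃-syntax; _,_; proj₂)
open import Data.Rational using (mkℚ; _/_; toℚᵘ) renaming (_*_ to _*ℚ_; _≤_ to _≤ℚ_)
import Data.Rational.Properties as ℚ
open import Data.Rational.Unnormalised as ℚᵘ using (mkℚᵘ; *≤*; *<*; _≃_)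
import Data.Rational.Unnormalised.Properties as ℚᵘ
open import Data.Sum using (inj₁; inj₂)
open import Function using (_∘_; id)
open import Relation.Binary.PropositionalEquality as ≡
  using (_≡_; _≢_; refl; trans; cong; cong₂; subst; subst₂; module ≡-Reasoning)
open import Relation.Nullary using (yes; no; does)
open import Relation.Unary using (Pred)
open import Algebra.Properties.CommutativeMonoid.Sum +-0-commutativeMonoid
  using (sum; sum-syntax; sum-cong-≗; ∑-distrib-+)

-- Sums over pairs and triples of indices

∑-const : ∀ r c → ∑[ i < r ] c ≡ r * c
∑-const zero c = refl
∑-const (suc r) c = cong (c +_) (∑-const r c)

∑-mono-≤ : ∀ {r} {f g : Fin r → ℕ} → (∀ i → f i ≤ g i) → sum f ≤ sum g
∑-mono-≤ {zero} f≤g = z≤n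
∑-mono-≤ {suc r} f≤g = +-mono-≤ (f≤g zero) (∑-mono-≤ (f≤g ∘ suc))

sum-tabulate : ∀ {r} (f : Fin r → ℕ) → List.sum (tabulate f) ≡ sum f
sum-tabulate {zero} f = refl
sum-tabulate {suc r} f = cong (f zero +_) (sum-tabulate (f ∘ suc))

sum-map-allFin : ∀ r (f : Fin r → ℕ) → List.sum (map f (allFin r)) ≡ sum f
sum-map-allFin r f = trans (cong List.sum (map-tabulate id f)) (sum-tabulate f)

∑-pairs : (r : ℕ) → (Fin r → Fin r → ℕ) → ℕ
∑-pairs zero d = 0
∑-pairs (suc r) d = ∑[ j < r ] d zero (suc j) + ∑-pairs r (λ i j → d (suc i) (suc j))

pairSum≡∑-pairs : ∀ r d → pairSum r d ≡ ∑-pairs r d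
pairSum≡∑-pairs r d =
  trans (sum-map-allFin r _) (trans (sum-cong-≗ {r} λ i → sum-map-allFin r _) (∑-ordered≡∑-pairs r d))
  where
  ∑-ordered : (r : ℕ) → (Fin r → Fin r → ℕ) → ℕ
  ∑-ordered r d = ∑[ i < r ] ∑[ j < r ] (if toℕ i <ᵇ toℕ j then d i j else 0)
  ∑-ordered≡∑-pairs : ∀ r d → ∑-ordered r d ≡ ∑-pairs r d
  ∑-ordered≡∑-pairs zero d = refl
  ∑-ordered≡∑-pairs (suc r) d =
    cong (∑[ j < r ] d zero (suc j) +_) (∑-ordered≡∑-pairs r (λ i j → d (suc i) (suc j)))

∑-pairs-cong : ∀ r {d e : Fin r → Fin r → ℕ} →
               (∀ {i j} → i ≢ j → d i j ≡ e i j) → ∑-pairs r d ≡ ∑-pairs r e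
∑-pairs-cong zero d≡e = refl
∑-pairs-cong (suc r) d≡e =
  cong₂ _+_ (sum-cong-≗ {r} λ _ → d≡e λ ()) (∑-pairs-cong r λ i≢j → d≡e (i≢j ∘ suc-injective))

∑-pairs-mono-≤ : ∀ r {d e : Fin r → Fin r → ℕ} →
                 (∀ i j → d i j ≤ e i j) → ∑-pairs r d ≤ ∑-pairs r e
∑-pairs-mono-≤ zero d≤e = z≤n
∑-pairs-mono-≤ (suc r) d≤e =
  +-mono-≤ (∑-mono-≤ (d≤e zero ∘ suc)) (∑-pairs-mono-≤ r λ i j → d≤e (suc i) (suc j))

∑-pairs-distrib-+ : ∀ r (d e : Fin r → Fin r → ℕ) →
                    ∑-pairs r (λ i j → d i j + e i j) ≡ ∑-pairs r d + ∑-pairs r e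
∑-pairs-distrib-+ zero d e = refl
∑-pairs-distrib-+ (suc r) d e = begin
  ∑[ j < r ] (d₀ j + e₀ j) + ∑-pairs r (λ i j → d′ i j + e′ i j)
    ≡⟨ cong₂ _+_ (∑-distrib-+ d₀ e₀) (∑-pairs-distrib-+ r d′ e′) ⟩
  (sum d₀ + sum e₀) + (∑-pairs r d′ + ∑-pairs r e′)
    ≡⟨ interchange +-commutativeSemigroup (sum d₀) (sum e₀) (∑-pairs r d′) (∑-pairs r e′) ⟩
  (sum d₀ + ∑-pairs r d′) + (sum e₀ + ∑-pairs r e′) ∎
  where
  open ≡-Reasoning
  d₀ e₀ : Fin r → ℕ
  d₀ j = d zero (suc j)
  e₀ j = e zero (suc j)
  d′ e′ : Fin r → Fin r → ℕ
  d′ i j = d (suc i) (suc j)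
  e′ i j = e (suc i) (suc j)

∑-pairs-+ : ∀ r (f : Fin r → ℕ) → ∑-pairs r (λ i j → f i + f j) ≡ (r ∸ 1) * sum f
∑-pairs-+ zero f = refl
∑-pairs-+ (suc zero) f = refl
∑-pairs-+ (suc r@(suc r′)) f = begin
  ∑[ j < r ] (f zero + f′ j) + ∑-pairs r (λ i j → f′ i + f′ j)
    ≡⟨ cong₂ _+_ (∑-distrib-+ (λ _ → f zero) f′) (∑-pairs-+ r f′) ⟩
  (∑[ j < r ] f zero + sum f′) + r′ * sum f′
    ≡⟨ cong (λ x → (x + sum f′) + r′ * sum f′) (∑-const r (f zero)) ⟩
  (r * f zero + sum f′) + r′ * sum f′
    ≡⟨ collect r′ (f zero) (sum f′) ⟩
  r * (f zero + sum f′) ∎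
  where
  open ≡-Reasoning
  f′ : Fin r → ℕ
  f′ = f ∘ suc
  collect : ∀ r′ a s → (suc r′ * a + s) + r′ * s ≡ suc r′ * (a + s)
  collect = solve-∀

∑-triples : (r : ℕ) → (Fin r → Fin r → Fin r → ℕ) → ℕ
∑-triples zero t = 0
∑-triples (suc r) t = ∑-pairs r (λ j k → t zero (suc j) (suc k))
                    + ∑-triples r (λ i j k → t (suc i) (suc j) (suc k))

∑-triples-mono-≤ : ∀ r {t u : Fin r → Fin r → Fin r → ℕ} →
                   (∀ i j k → t i j k ≤ u i j k) → ∑-triples r t ≤ ∑-triples r u
∑-triples-mono-≤ zero t≤u = z≤n
∑-triples-mono-≤ (suc r) t≤u =
  +-mono-≤ (∑-pairs-mono-≤ r λ j k → t≤u zero (suc j) (suc k))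
           (∑-triples-mono-≤ r λ i j k → t≤u (suc i) (suc j) (suc k))

∑-triples-triangle : ∀ r (d : Fin r → Fin r → ℕ) →
  ∑-triples r (λ i j k → d i j + d i k + d j k) ≡ (r ∸ 2) * ∑-pairs r d
∑-triples-triangle zero d = refl
∑-triples-triangle (suc zero) d = refl
∑-triples-triangle (suc (suc zero)) d = refl
∑-triples-triangle (suc r@(suc (suc r′))) d = begin
  ∑-pairs r (λ j k → (d₀ j + d₀ k) + d′ j k) + ∑-triples r (λ i j k → d′ i j + d′ i k + d′ j k)
    ≡⟨ cong₂ _+_ (∑-pairs-distrib-+ r (λ j k → d₀ j + d₀ k) d′) (∑-triples-triangle r d′) ⟩
  (∑-pairs r (λ j k → d₀ j + d₀ k) + P′) + r′ * P′
    ≡⟨ cong (λ x → (x + P′) + r′ * P′) (∑-pairs-+ r d₀) ⟩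
  (suc r′ * sum d₀ + P′) + r′ * P′
    ≡⟨ collect r′ (sum d₀) P′ ⟩
  suc r′ * (sum d₀ + P′) ∎
  where
  open ≡-Reasoning
  d₀ : Fin r → ℕ
  d₀ j = d zero (suc j)
  d′ : Fin r → Fin r → ℕ
  d′ i j = d (suc i) (suc j)
  P′ : ℕ
  P′ = ∑-pairs r d′
  collect : ∀ r′ s p → (suc r′ * s + p) + r′ * p ≡ suc r′ * (s + p)
  collect = solve-∀

triangle≤⇒∑-pairs≤ : ∀ r → 3 ≤ r → (d : Fin r → Fin r → ℕ) (b : ℕ) →
  (∀ i j k → d i j + d i k + d j k ≤ 3 * b) → ∑-pairs r d ≤ ∑-pairs r (λ _ _ → b)
triangle≤⇒∑-pairs≤ r@(suc (suc (suc m))) (s≤s (s≤s (s≤s _))) d b triangle≤ =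
  *-cancelˡ-≤ (suc m) (begin
    suc m * ∑-pairs r d                               ≡⟨ ∑-triples-triangle r d ⟨
    ∑-triples r (λ i j k → d i j + d i k + d j k)     ≤⟨ ∑-triples-mono-≤ r triangle≤′ ⟩
    ∑-triples r (λ _ _ _ → b + b + b)                 ≡⟨ ∑-triples-triangle r (λ _ _ → b) ⟩
    suc m * ∑-pairs r (λ _ _ → b)                     ∎)
  where
  open ≤-Reasoning
  thrice : ∀ b → 3 * b ≡ b + b + b
  thrice = solve-∀
  triangle≤′ : ∀ i j k → d i j + d i k + d j k ≤ b + b + b
  triangle≤′ i j k = ≤-trans (triangle≤ i j k) (≤-reflexive (thrice b))

-- Walks, chains and dominating sets

module _ {n : ℕ} (G : Graph n) where

  open import Data.List.Membership.DecPropositional (_≟_ {n}) using (_∈_; _∉_; _∈?_)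

  infixr 5 _++ʷ_ _∷ᶜ_

  _++ʷ_ : ∀ {x y z a b} → Walk G x y a → Walk G y z b → Walk G x z (a + b)
  here _   ++ʷ w′ = w′
  step e w ++ʷ w′ = step e (w ++ʷ w′)

  reverseʷ : ∀ {x y k} → Walk G x y k → Walk G y x k
  reverseʷ (here x) = here x
  reverseʷ {k = suc k} (step {x = x} {y = y} e w) =
    subst (Walk G _ x) (+-comm k 1) (reverseʷ w ++ʷ step (trans (Graph.sym G y x) e) (here x))

  WalkWithin : ℕ → Fin n → Fin n → Set
  WalkWithin ℓ u v = ∃[ k ] k ≤ ℓ × Walk G u v k

  -- A walk u → w cut into hops of length at most ℓ at the listed vertices.
  data Chain (ℓ : ℕ) : Fin n → Fin n → List (Fin n) → Set where
    [_]ᶜ : ∀ u → Chain ℓ u u [ u ]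
    _∷ᶜ_ : ∀ {u v w vs} → WalkWithin ℓ u v → Chain ℓ v w vs → Chain ℓ u w (u ∷ vs)

  module _ {ℓ : ℕ} where

    private
      hop-≤ : ∀ {m k L} → m ≤ ℓ → k + ℓ ≤ ℓ * L → m + k + ℓ ≤ ℓ * suc L
      hop-≤ {m} {k} {L} m≤ℓ k≤ = begin
        m + k + ℓ    ≡⟨ +-assoc m k ℓ ⟩
        m + (k + ℓ)  ≤⟨ +-mono-≤ m≤ℓ k≤ ⟩
        ℓ + ℓ * L    ≡⟨ *-suc ℓ L ⟨
        ℓ * suc L    ∎
        where open ≤-Reasoning

    chain-head : ∀ {u w vs} → Chain ℓ u w vs → u ∈ vs
    chain-head [ u ]ᶜ = here refl
    chain-head (_ ∷ᶜ _) = here refl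

    chain-walk : ∀ {u w vs} → Chain ℓ u w vs → ∃[ k ] Walk G u w k × k + ℓ ≤ ℓ * length vs
    chain-walk [ u ]ᶜ = 0 , here u , ≤-reflexive (≡.sym (*-identityʳ ℓ))
    chain-walk ((m , m≤ℓ , wm) ∷ᶜ c) with chain-walk c
    ... | k , wk , k≤ = m + k , wm ++ʷ wk , hop-≤ m≤ℓ k≤

    chain-split : ∀ {u w t vs} → Chain ℓ u w vs → t ∈ vs →
      ∃[ k₁ ] ∃[ k₂ ] Walk G u t k₁ × Walk G t w k₂ × k₁ + k₂ + ℓ ≤ ℓ * length vs
    chain-split [ u ]ᶜ (here refl) = 0 , 0 , here u , here u , ≤-reflexive (≡.sym (*-identityʳ ℓ))
    chain-split c@(_ ∷ᶜ _) (here refl) with chain-walk c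
    ... | k , wk , k≤ = 0 , k , here _ , wk , k≤
    chain-split ((m , m≤ℓ , wm) ∷ᶜ c) (there t∈) with chain-split c t∈
    ... | k₁ , k₂ , w₁ , w₂ , k≤ =
      m + k₁ , k₂ , wm ++ʷ w₁ , w₂ ,
      ≤-trans (≤-reflexive (cong (_+ ℓ) (+-assoc m k₁ k₂))) (hop-≤ m≤ℓ k≤)

    module _ {p} {P : Pred (Fin n) p} where

      chain-suffix : ∀ {u v w vs} → Chain ℓ v w vs → Unique vs → All P vs → u ∈ vs →
                     ∃[ ws ] Chain ℓ u w ws × Unique ws × All P ws
      chain-suffix c@([ _ ]ᶜ) uq ps (here refl) = _ , c , uq , ps
      chain-suffix c@(_ ∷ᶜ _) uq ps (here refl) = _ , c , uq , ps
      chain-suffix (_ ∷ᶜ c) (_ ∷ uq) (_ ∷ ps) (there u∈) = chain-suffix c uq ps u∈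

      chain-dedup : ∀ {u w vs} → Chain ℓ u w vs → All P vs →
                    ∃[ ws ] Chain ℓ u w ws × Unique ws × All P ws
      chain-dedup [ u ]ᶜ ps = _ , [ u ]ᶜ , [] ∷ [] , ps
      chain-dedup {u} (h ∷ᶜ c) (pu ∷ ps) with chain-dedup c ps
      ... | ws , c′ , uq , ps′ with u ∈? ws
      ...   | yes u∈ = chain-suffix c′ uq ps′ u∈
      ...   | no u∉ = u ∷ ws , h ∷ᶜ c′ , All.¬Any⇒All¬ ws u∉ ∷ uq , pu ∷ ps′

      -- Qs: the chain's vertices before it first meets Ps (at w), with the walk from u to w.
      chain-enter : ∀ (Ps : List (Fin n)) {u a vs} → Chain ℓ u a vs → a ∈ Ps → Unique vs → All P vs →
        ∃[ w ] ∃[ Qs ] ∃[ k ] w ∈ Ps × Walk G u w k × k ≤ ℓ * length Qs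
                            × Unique Qs × All (_∉ Ps) Qs × All P Qs × All (_∈ vs) Qs
      chain-enter Ps {u} c a∈ uq ps with u ∈? Ps
      ... | yes u∈ = u , [] , 0 , u∈ , here u , z≤n , [] , [] , [] , []
      chain-enter Ps [ u ]ᶜ a∈ uq ps | no u∉ = ⊥-elim (u∉ a∈)
      chain-enter Ps ((m , m≤ℓ , wm) ∷ᶜ c) a∈ (u∉vs ∷ uq) (pu ∷ ps) | no u∉
        with chain-enter Ps c a∈ uq ps
      ... | w , Qs , k , w∈ , wk , k≤ , uqQ , Q∉ , psQ , Q⊆ =
        w , _ ∷ Qs , m + k , w∈ , wm ++ʷ wk ,
        ≤-trans (+-mono-≤ m≤ℓ k≤) (≤-reflexive (≡.sym (*-suc ℓ (length Qs)))) ,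
        All.map (All.lookup u∉vs) Q⊆ ∷ uqQ , u∉ ∷ Q∉ , pu ∷ psQ , here refl ∷ All.map there Q⊆

  unique⇒length≤∣_∣ : ∀ S {vs : List (Fin n)} → Unique vs → All (_∈ₛ S) vs → length vs ≤ ∣ S ∣
  unique⇒length≤∣ S ∣ [] [] = z≤n
  unique⇒length≤∣ S ∣ {v ∷ vs} (v∉ ∷ uq) (v∈ ∷ vs∈) =
    ≤-trans (s≤s (unique⇒length≤∣ S - v ∣ uq vs∈S-v)) (x∈p⇒∣p-x∣<∣p∣ v∈)
    where
    vs∈S-v : All (_∈ₛ S - v) vs
    vs∈S-v = All.zipWith (λ (v≢ , v∈) → x∈p∧x≢y⇒x∈p-y v∈ (v≢ ∘ ≡.sym)) (v∉ , vs∈)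

  IsDist⇒≤ : ∀ {x y d k} → IsDist G x y d → Walk G x y k → d ≤ k
  IsDist⇒≤ (_ , shortest) w = shortest _ w

  triangle-≤-hub : ∀ {x y z w α β δ dxy dxz dyz} →
    IsDist G x y dxy → IsDist G x z dxz → IsDist G y z dyz →
    Walk G x w α → Walk G y w β → Walk G z w δ →
    dxy + dxz + dyz ≤ (α + β + δ) + (α + β + δ)
  triangle-≤-hub {α = α} {β} {δ} {dxy} {dxz} {dyz} xy xz yz wx wy wz = begin
    dxy + dxz + dyz                  ≤⟨ +-mono-≤ (+-mono-≤ (IsDist⇒≤ xy (wx ++ʷ reverseʷ wy))
                                                            (IsDist⇒≤ xz (wx ++ʷ reverseʷ wz)))
                                                  (IsDist⇒≤ yz (wy ++ʷ reverseʷ wz)) ⟩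
    (α + β) + (α + δ) + (β + δ)      ≡⟨ regroup α β δ ⟩
    (α + β + δ) + (α + β + δ)        ∎
    where
    open ≤-Reasoning
    regroup : ∀ α β δ → (α + β) + (α + δ) + (β + δ) ≡ (α + β + δ) + (α + β + δ)
    regroup = solve-∀

  module _ {S : Subset n} (dominating : Dominating G S) where

    dominator : ∀ v → ∃[ u ] u ∈ₛ S × WalkWithin 1 v u
    dominator v with dominating v
    ... | inj₁ v∈S = v , v∈S , 0 , z≤n , here v
    ... | inj₂ (u , u∈S , e) = u , u∈S , 1 , ≤-refl , step e (here u)

    -- Consecutive vertices of the walk have dominators at distance ≤ 1 + 1 + 1.
    walk⇒chain : ∀ {u v b k} → u ∈ₛ S → WalkWithin 1 u v → Walk G v b k → b ∈ₛ S →
                 ∃[ vs ] Chain 3 u b vs × All (_∈ₛ S) vs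
    walk⇒chain u∈S (m , m≤1 , wm) (here b) b∈S =
      _ , (m , ≤-trans m≤1 (s≤s z≤n) , wm) ∷ᶜ [ b ]ᶜ , u∈S ∷ b∈S ∷ []
    walk⇒chain {u} u∈S (m , m≤1 , wm) (step {y = v′} e w) b∈S with dominator v′
    ... | u′ , u′∈S , m′ , m′≤1 , wm′ with walk⇒chain u′∈S (m′ , m′≤1 , reverseʷ wm′) w b∈S
    ... | vs , c , vs⊆S =
      u ∷ vs , (m + suc m′ , +-mono-≤ m≤1 (s≤s m′≤1) , wm ++ʷ step e wm′) ∷ᶜ c , u∈S ∷ vs⊆S

    unique-chain : Connected G → ∀ {u b} → u ∈ₛ S → b ∈ₛ S →
                   ∃[ vs ] Chain 3 u b vs × Unique vs × All (_∈ₛ S) vs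
    unique-chain connected {u} {b} u∈S b∈S
      with walk⇒chain u∈S (0 , z≤n , here u) (proj₂ (connected u b)) b∈S
    ... | vs , c , vs⊆S = chain-dedup c vs⊆S

    -- With a, b, c dominating x, y, z: a chain of distinct S-vertices from a to b, and one from c up to
    -- its first vertex w on the former, are disjoint, so together they have at most |S| vertices.
    hub : Connected G → ∀ x y z → ∃[ w ] ∃[ α ] ∃[ β ] ∃[ δ ]
          Walk G x w α × Walk G y w β × Walk G z w δ × α + β + δ ≤ 3 * ∣ S ∣
    hub connected x y z with dominator x | dominator y | dominator z
    ... | a , a∈S , ex , ex≤1 , wx | b , b∈S , ey , ey≤1 , wy | c , c∈S , ez , ez≤1 , wz
      with unique-chain connected a∈S b∈S | unique-chain connected c∈S a∈S
    ... | Ps , chainP , uqP , P⊆S | _ , chainU , uqU , U⊆S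
      with chain-enter Ps chainU (chain-head chainP) uqU U⊆S
    ... | w , Qs , kq , w∈P , wq , kq≤ , uqQ , Q∉P , Q⊆S , _
      with chain-split chainP w∈P
    ... | k₁ , k₂ , w₁ , w₂ , k₁₂≤ =
      w , ex + k₁ , ey + k₂ , ez + kq , wx ++ʷ w₁ , wy ++ʷ reverseʷ w₂ , wz ++ʷ wq ,
      length≤ {p = length Ps} {q = length Qs} ex≤1 ey≤1 ez≤1 k₁₂≤ kq≤ (begin
        length Ps + length Qs  ≡⟨ length-++ Ps ⟨
        length (Ps ++ Qs)      ≤⟨ unique⇒length≤∣ S ∣ (Unique.++⁺ uqP uqQ disjoint) (All.++⁺ P⊆S Q⊆S) ⟩
        ∣ S ∣                   ∎)
      where
      open ≤-Reasoning
      disjoint : ∀ {v} → ¬ (v ∈ Ps × v ∈ Qs)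
      disjoint (v∈P , v∈Q) = All.lookup Q∉P v∈Q v∈P
      length≤ : ∀ {ex ey ez k₁ k₂ kq p q s} → ex ≤ 1 → ey ≤ 1 → ez ≤ 1 →
                k₁ + k₂ + 3 ≤ 3 * p → kq ≤ 3 * q → p + q ≤ s →
                (ex + k₁) + (ey + k₂) + (ez + kq) ≤ 3 * s
      length≤ {ex} {ey} {ez} {k₁} {k₂} {kq} {p} {q} {s} ex≤ ey≤ ez≤ k₁₂≤ kq≤ p+q≤ = begin
        (ex + k₁) + (ey + k₂) + (ez + kq)    ≡⟨ regroup ex ey ez k₁ k₂ kq ⟩
        (k₁ + k₂ + (ex + ey + ez)) + kq      ≤⟨ +-mono-≤ (+-monoʳ-≤ (k₁ + k₂) e≤3) kq≤ ⟩
        (k₁ + k₂ + 3) + 3 * q                ≤⟨ +-monoˡ-≤ (3 * q) k₁₂≤ ⟩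
        3 * p + 3 * q                        ≡⟨ *-distribˡ-+ 3 p q ⟨
        3 * (p + q)                          ≤⟨ *-monoʳ-≤ 3 p+q≤ ⟩
        3 * s                                ∎
        where
        e≤3 : ex + ey + ez ≤ 3
        e≤3 = +-mono-≤ (+-mono-≤ ex≤ ey≤) ez≤
        regroup : ∀ ex ey ez k₁ k₂ kq →
                  (ex + k₁) + (ey + k₂) + (ez + kq) ≡ (k₁ + k₂ + (ex + ey + ez)) + kq
        regroup = solve-∀

    dist-triangle-≤ : Connected G → ∀ {x y z dxy dxz dyz} →
      IsDist G x y dxy → IsDist G x z dxz → IsDist G y z dyz → dxy + dxz + dyz ≤ 6 * ∣ S ∣
    dist-triangle-≤ connected {x} {y} {z} {dxy} {dxz} {dyz} xy xz yz =
      let (w , α , β , δ , wx , wy , wz , L≤) = hub connected x y z in begin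
        dxy + dxz + dyz                    ≤⟨ triangle-≤-hub xy xz yz wx wy wz ⟩
        (α + β + δ) + (α + β + δ)          ≤⟨ +-mono-≤ L≤ L≤ ⟩
        3 * ∣ S ∣ + 3 * ∣ S ∣              ≡⟨ *-distribʳ-+ ∣ S ∣ 3 3 ⟨
        6 * ∣ S ∣                          ∎
      where open ≤-Reasoning

pairSum-dist-≤ : ∀ {n} (G : Graph n) {S : Subset n} → Dominating G S → Connected G →
  ∀ r → 3 ≤ r → (x : Fin r → Fin n) (d : Fin r → Fin r → ℕ) →
  (∀ i j → IsDist G (x i) (x j) (d i j)) → pairSum r d ≤ r * (r ∸ 1) * ∣ S ∣
pairSum-dist-≤ G {S} dominating connected r 3≤r x d isDist = begin
  pairSum r d                  ≡⟨ pairSum≡∑-pairs r d ⟩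
  ∑-pairs r d                  ≤⟨ triangle≤⇒∑-pairs≤ r 3≤r d (γ + γ) triangle≤ ⟩
  ∑-pairs r (λ _ _ → γ + γ)    ≡⟨ ∑-pairs-+ r (λ _ → γ) ⟩
  (r ∸ 1) * ∑[ i < r ] γ       ≡⟨ cong ((r ∸ 1) *_) (∑-const r γ) ⟩
  (r ∸ 1) * (r * γ)            ≡⟨ reorder (r ∸ 1) r γ ⟩
  r * (r ∸ 1) * γ              ∎
  where
  open ≤-Reasoning
  γ : ℕ
  γ = ∣ S ∣
  reorder : ∀ a b c → a * (b * c) ≡ b * a * c
  reorder = solve-∀
  sixfold : ∀ c → 6 * c ≡ 3 * (c + c)
  sixfold = solve-∀
  triangle≤ : ∀ i j k → d i j + d i k + d j k ≤ 3 * (γ + γ)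
  triangle≤ i j k =
    ≤-trans (dist-triangle-≤ G dominating connected (isDist i j) (isDist i k) (isDist j k))
            (≤-reflexive (sixfold γ))

-- The star K₁,ᵣ

star-adj : ∀ {r} → Fin (suc r) → Fin (suc r) → Bool
star-adj zero    zero    = false
star-adj zero    (suc _) = true
star-adj (suc _) zero    = true
star-adj (suc _) (suc _) = false

star : ∀ r → Graph (suc r)
star r = record { adj = star-adj ; sym = star-adj-sym ; irrefl = star-adj-irrefl }
  where
  star-adj-sym : ∀ (x y : Fin (suc r)) → star-adj x y ≡ star-adj y x
  star-adj-sym zero    zero    = refl
  star-adj-sym zero    (suc _) = refl
  star-adj-sym (suc _) zero    = refl
  star-adj-sym (suc _) (suc _) = refl
  star-adj-irrefl : ∀ (x : Fin (suc r)) → star-adj x x ≡ false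
  star-adj-irrefl zero    = refl
  star-adj-irrefl (suc _) = refl

star-connected : ∀ r → Connected (star r)
star-connected r zero    zero    = 0 , here zero
star-connected r zero    (suc j) = 1 , step refl (here _)
star-connected r (suc i) zero    = 1 , step refl (here _)
star-connected r (suc i) (suc j) = 2 , step {y = zero} refl (step refl (here _))

star-γ≡1 : ∀ r → IsDomNum (star r) 1
star-γ≡1 r = (⁅ zero ⁆ , centre-dominates , ∣⁅x⁆∣≡1 {n = suc r} zero) , 1≤∣S∣
  where
  centre-dominates : Dominating (star r) ⁅ zero ⁆
  centre-dominates zero    = inj₁ (x∈⁅x⁆ zero)
  centre-dominates (suc _) = inj₂ (zero , x∈⁅x⁆ zero , refl)
  nonempty : ∀ {S : Subset (suc r)} {x} → x ∈ₛ S → 1 ≤ ∣ S ∣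
  nonempty x∈S = ≤-trans (s≤s z≤n) (x∈p⇒∣p-x∣<∣p∣ x∈S)
  1≤∣S∣ : ∀ S → Dominating (star r) S → 1 ≤ ∣ S ∣
  1≤∣S∣ S dominating with dominating zero
  ... | inj₁ zero∈S = nonempty zero∈S
  ... | inj₂ (_ , u∈S , _) = nonempty u∈S

leafDist : ∀ {r} → Fin r → Fin r → ℕ
leafDist i j = if does (i ≟ j) then 0 else 2

star-leafDist : ∀ r (i j : Fin r) → IsDist (star r) (suc i) (suc j) (leafDist i j)
star-leafDist r i j with i ≟ j
... | yes refl = here _ , λ _ _ → z≤n
... | no i≢j = step {y = zero} refl (step refl (here _)) , 2≤
  where
  2≤ : ∀ m → Walk (star r) (suc i) (suc j) m → 2 ≤ m
  2≤ _ (here _) = ⊥-elim (i≢j refl)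
  2≤ _ (step () (here _))
  2≤ _ (step _ (step _ _)) = s≤s (s≤s z≤n)

pairSum-leafDist : ∀ r → pairSum r leafDist ≡ r * (r ∸ 1)
pairSum-leafDist r = begin
  pairSum r leafDist            ≡⟨ pairSum≡∑-pairs r leafDist ⟩
  ∑-pairs r leafDist            ≡⟨ ∑-pairs-cong r leafDist-≢ ⟩
  ∑-pairs r (λ _ _ → 1 + 1)     ≡⟨ ∑-pairs-+ r (λ _ → 1) ⟩
  (r ∸ 1) * ∑[ i < r ] 1        ≡⟨ cong ((r ∸ 1) *_) (∑-const r 1) ⟩
  (r ∸ 1) * (r * 1)             ≡⟨ reorder (r ∸ 1) r ⟩
  r * (r ∸ 1)                   ∎
  where
  open ≡-Reasoning
  leafDist-≢ : ∀ {i j : Fin r} → i ≢ j → leafDist i j ≡ 2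
  leafDist-≢ {i} {j} i≢j with i ≟ j
  ... | yes i≡j = ⊥-elim (i≢j i≡j)
  ... | no _ = refl
  reorder : ∀ a b → a * (b * 1) ≡ b * a
  reorder = solve-∀

-- Rational arithmetic

toℚᵘ-/ : ∀ i n .{{_ : NonZero n}} → toℚᵘ (i / n) ≃ i ℚᵘ./ n
toℚᵘ-/ i (suc m) = ℚ.toℚᵘ-fromℚᵘ (mkℚᵘ i m)

toℚᵘ-homo-*-/ : ∀ p i n .{{_ : NonZero n}} → toℚᵘ (p *ℚ (i / n)) ≃ toℚᵘ p ℚᵘ.* (i ℚᵘ./ n)
toℚᵘ-homo-*-/ p i n = ℚᵘ.≃-trans (ℚ.toℚᵘ-homo-* p (i / n)) (ℚᵘ.*-congˡ {toℚᵘ p} (toℚᵘ-/ i n))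

1/n*s≤g : ∀ n .{{_ : NonZero n}} {s g} → s ≤ n * g → (ℤ.+ 1 / n) *ℚ toℚ s ≤ℚ toℚ g
1/n*s≤g n@(suc m) {s} {g} s≤ng = ℚ.toℚᵘ-cancel-≤
  (ℚᵘ.≤-respˡ-≃ (ℚᵘ.≃-sym lhs) (ℚᵘ.≤-respʳ-≃ (ℚᵘ.≃-sym (toℚᵘ-/ (ℤ.+ g) 1)) (*≤* cross)))
  where
  lhs : toℚᵘ ((ℤ.+ 1 / n) *ℚ toℚ s) ≃ mkℚᵘ (ℤ.+ 1) m ℚᵘ.* mkℚᵘ (ℤ.+ s) 0
  lhs = ℚᵘ.≃-trans (toℚᵘ-homo-*-/ (ℤ.+ 1 / n) (ℤ.+ s) 1) (ℚᵘ.*-congʳ (toℚᵘ-/ (ℤ.+ 1) n))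
  cross : (ℤ.+ 1 ℤ.* ℤ.+ s) ℤ.* ℤ.+ 1 ℤ.≤ ℤ.+ g ℤ.* ℤ.+ (n * 1)
  cross = subst₂ ℤ._≤_
    (≡.sym (trans (ℤ.*-identityʳ _) (ℤ.*-identityˡ (ℤ.+ s))))
    (trans (cong ℤ.+_ (trans (*-comm n g) (cong (g *_) (≡.sym (*-identityʳ n))))) (ℤ.pos-* g _))
    (ℤ.+≤+ s≤ng)

1/n<q⇒1<q*n : ∀ n .{{_ : NonZero n}} {q} → ℤ.+ 1 / n < q → toℚ 1 < q *ℚ toℚ n
1/n<q⇒1<q*n n@(suc m) {q@(mkℚ z e _)} 1/n<q = ℚ.toℚᵘ-cancel-<
  (ℚᵘ.<-respˡ-≃ (ℚᵘ.≃-sym (toℚᵘ-/ (ℤ.+ 1) 1))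
    (ℚᵘ.<-respʳ-≃ (ℚᵘ.≃-sym (toℚᵘ-homo-*-/ q (ℤ.+ n) 1)) (*<* cross)))
  where
  cross : ℤ.+ 1 ℤ.* ℤ.+ (suc e * 1) ℤ.< (z ℤ.* ℤ.+ n) ℤ.* ℤ.+ 1
  cross with ℚᵘ.<-respˡ-≃ (toℚᵘ-/ (ℤ.+ 1) n) (ℚ.toℚᵘ-mono-< 1/n<q)
  ... | *<* 1*e<z*n = subst₂ ℤ._<_ (cong (λ k → ℤ.+ 1 ℤ.* ℤ.+ k) (≡.sym (*-identityʳ (suc e))))
                                  (≡.sym (ℤ.*-identityʳ (z ℤ.* ℤ.+ n))) 1*e<z*n

theorem3 : ∀ (r : ℕ) → 3 ≤ r →
    Valid r (Cr r) × (∀ (c : ℚ) → Cr r < c → ¬ Valid r c)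
theorem3 r@(suc (suc (suc _))) 3≤r@(s≤s (s≤s (s≤s _))) = valid , optimal
  where
  valid : Valid r (Cr r)
  valid n G _ connected g ((S , dominating , ∣S∣≡g) , _) x d isDist =
    1/n*s≤g (r * (r ∸ 1)) {pairSum r d} {g}
      (subst (λ γ → pairSum r d ≤ r * (r ∸ 1) * γ) ∣S∣≡g
        (pairSum-dist-≤ G dominating connected r 3≤r x d isDist))
  optimal : ∀ c → Cr r < c → ¬ Valid r c
  optimal c Cr<c valid = ℚ.<-irrefl refl (ℚ.<-≤-trans (1/n<q⇒1<q*n (r * (r ∸ 1)) Cr<c)
    (subst (λ s → c *ℚ toℚ s ≤ℚ toℚ 1) (pairSum-leafDist r)
      (valid (suc r) (star r) (s≤s (s≤s z≤n)) (star-connected r) 1 (star-γ≡1 r)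
             suc leafDist (star-leafDist r))))
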